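{- Let $H$ be a group of order $10$, $15$ or $20$, and let $\Gamma$ be a group extension of $\mathbb{Z}/5\mathbb{Z}$ by $H$ (i.e. $H$ is a normal subgroup of $\Gamma$ with $\Gamma/H\cong\mathbb{Z}/5\mathbb{Z}$). Then the abelianization $\Gamma^{ab}$ is not a $5$-group. -}

module Defs where

open import Level using (Level; _⊔_)
open import Data.Nat using (ℕ; zero; suc; _+_; _^_)
open import Data.Nat.DivMod using (_mod_)
open import Data.Fin using (Fin; toℕ)
import Data.Fin as Fin
import Data.Nat
open import Data.Product using (Σ; ∃; _×_; _,_)
open import Relation.Binary.PropositionalEquality using (_≡_)
open import Algebra.Bundles using (Group)
open import Algebra.Bundles.Raw using (RawGroup)
open import Algebra.Morphism.Structures using (module GroupMorphisms)

ℤ/5-rawGroup : RawGroup Level.zero Level.zero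
ℤ/5-rawGroup = record
  { Carrier = Fin 5
  ; _≈_ = _≡_
  ; _∙_ = λ i j → (toℕ i + toℕ j) mod 5
  ; ε = Fin.zero
  ; _⁻¹ = λ i → (5 Data.Nat.∸ toℕ i) mod 5
  }

module _ {c ℓ : Level} (G : Group c ℓ) where
  open Group G

  HasOrder : ℕ → Set (c ⊔ ℓ)
  HasOrder n = Σ (Fin n → Carrier) λ f →
                 (∀ i j → f i ≈ f j → i ≡ j) × (∀ x → ∃ λ i → f i ≈ x)

  [_,_] : Carrier → Carrier → Carrier
  [ a , b ] = a ⁻¹ ∙ b ⁻¹ ∙ a ∙ b

  data InDerived : Carrier → Set (c ⊔ ℓ) where
    d-ε    : ∀ {x} → x ≈ ε → InDerived x
    d-step : ∀ {x y} (a b : Carrier) → InDerived x → y ≈ x ∙ [ a , b ] → InDerived y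

  pow : Carrier → ℕ → Carrier
  pow x zero    = ε
  pow x (suc k) = x ∙ pow x k

  -- The abelianization G^ab = G/[G,G] is a p-group: every element of G^ab has
  -- order a power of p, i.e. for every x ∈ G some x^(p^k) lies in [G,G].
  AbelianizationIsPGroup : ℕ → Set (c ⊔ ℓ)
  AbelianizationIsPGroup p = ∀ x → ∃ λ k → InDerived (pow x (p ^ k))

record IsExtensionℤ/5 {c₁ ℓ₁ c₂ ℓ₂ : Level} (H : Group c₁ ℓ₁) (Γ : Group c₂ ℓ₂)
       : Set (c₁ ⊔ ℓ₁ ⊔ c₂ ⊔ ℓ₂) where
  open Group Γ
  field
    ι       : Group.Carrier H → Carrier
    ι-mono  : GroupMorphisms.IsGroupMonomorphism (Group.rawGroup H) (Group.rawGroup Γ) ι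
    π       : Carrier → Fin 5
    π-hom   : GroupMorphisms.IsGroupHomomorphism (Group.rawGroup Γ) ℤ/5-rawGroup π
    π-surj  : ∀ (k : Fin 5) → ∃ λ x → π x ≡ k
    exact   : ∀ x → (π x ≡ Fin.zero → ∃ λ h → ι h ≈ x) × (∀ h → ι h ≈ x → π x ≡ Fin.zero)

{-# OPTIONS --safe #-}
-- McKay's proof of Cauchy's theorem gives an element a ∈ H of order 5; let N = ⟨ι a⟩ ≤ Γ.
-- Since |H| < 25, among any five elements of ker π ≅ H two lie in the same coset of N.
-- Applied to w⁰, …, w⁴ this shows that w ∈ ker π with w⁵ ∈ N lies in N, so N is normal;
-- applied to ε, x, y, xy, yx it shows that ker π / N is abelian; applied to the conjugates
-- gⁱ h g⁻ⁱ it shows that every g ∈ Γ centralizes ker π modulo N. Since ker π and any preimage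
-- of 1 generate Γ, the quotient Γ / N is abelian, i.e. [Γ, Γ] ⊆ N. If Γᵃᵇ were a 5-group,
-- every w ∈ ker π would have some w^(5ᵏ) ∈ [Γ, Γ] ⊆ N, hence w ∈ N: impossible, as |H| > 5 = |N|.
module Submission where

open import Defs
open import Level using (Level; _⊔_)
open import Algebra.Bundles using (Group)
open import Algebra.Bundles.Raw using (RawGroup)
open import Algebra.Morphism.Structures using (module GroupMorphisms)
open import Data.Bool using (Bool; true; false; T; _∧_; _∨_; not; if_then_else_)
open import Data.Bool.Properties using (T?)
open import Data.Empty using (⊥; ⊥-elim)
open import Data.Fin using (Fin; zero; suc; toℕ; punchIn)
import Data.Fin as Fin
open import Data.Fin.Patterns using (0F; 1F; 2F; 3F; 4F)
open import Data.Fin.Properties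
  using (_≟_; any?; <-cmp; <-irrefl; toℕ<n; toℕ-fromℕ<; punchInᵢ≢i; *↔×; pigeonhole)
open import Data.Nat using (ℕ; zero; suc; _+_; _*_; _^_; _∸_; _%_; _/_; _≤_; _<_; _<?_; s≤s; z≤n)
open import Data.Nat.DivMod using (_mod_; m≡m%n+[m/n]*n; m%n<n)
open import Data.Nat.Divisibility using (_∣_; divides; n∣m*n; ∣m⇒∣m*n; ∣m+n∣m⇒∣n; ∣1⇒≡1)
open import Data.Nat.Properties
  using ( +-comm; *-comm; *-suc; +-0-commutativeMonoid; +-commutativeSemigroup
        ; ≤-refl; ≤-reflexive; ≤-trans; ≤-pred; n≤1+n; m<n⇒m<1+n; ≤∧≢⇒<; <⇒≤; ≤-<-trans
        ; m∸n+n≡m; m+[n∸m]≡n; m≤n+m; m<n⇒0<n∸m; m∸n≤m )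
  renaming (_≟_ to _≟ℕ_)
open import Data.Product using (∃; ∃₂; _×_; _,_; proj₁; proj₂)
open import Data.Product.Function.NonDependent.Propositional using (_×-↔_)
open import Data.Sum using (_⊎_; inj₁; inj₂)
open import Data.Vec.Functional using (Vector; []; _∷_)
open import Function using (_∘_; _↔_; Inverse; Injection; _⇔_; mk⇔)
open import Function.Properties.Inverse using (↔-refl; ↔-trans; ↔⇒↣)
open import Relation.Binary.Definitions using (tri<; tri≈; tri>)
open import Relation.Binary.PropositionalEquality as ≡
  using (_≡_; _≢_; _≗_; cong; cong₂; subst; module ≡-Reasoning)
open import Relation.Nullary using (¬_; Dec; yes; no; does; ¬?; _×-dec_; contradiction)
open import Relation.Nullary.Decidable as Dec using (dec-true; dec-false; does-≡; decidable-stable; from-yes)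
open import Algebra.Properties.CommutativeMonoid.Sum +-0-commutativeMonoid
  using (sum-syntax; sum-cong-≗; ∑-distrib-+; sum-remove; sum-replicate-zero)
open import Algebra.Properties.CommutativeSemigroup +-commutativeSemigroup using (x∙yz≈y∙xz)
open GroupMorphisms using (IsGroupHomomorphism; IsGroupMonomorphism)

invertible-mod-5 : ∀ {d} → 0 < d → d < 5 → ∃₂ λ m l → m * d ≡ 1 + l * 5
invertible-mod-5 {0} ()
invertible-mod-5 {1} _ _ = 1 , 0 , ≡.refl
invertible-mod-5 {2} _ _ = 3 , 1 , ≡.refl
invertible-mod-5 {3} _ _ = 2 , 1 , ≡.refl
invertible-mod-5 {4} _ _ = 4 , 3 , ≡.refl
invertible-mod-5 {suc (suc (suc (suc (suc _))))} _ (s≤s (s≤s (s≤s (s≤s (s≤s ())))))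

indicator : Bool → ℕ
indicator b = if b then 1 else 0

count : ∀ {K} → (Fin K → Bool) → ℕ
count {K} p = ∑[ i < K ] indicator (p i)

count-cong : ∀ {K} {p q : Fin K → Bool} → p ≗ q → count p ≡ count q
count-cong p≗q = sum-cong-≗ (cong indicator ∘ p≗q)

module _ {K : ℕ} where

  _∩_ _∖_ : (Fin K → Bool) → (Fin K → Bool) → Fin K → Bool
  (P ∩ Q) j = P j ∧ Q j
  (P ∖ Q) j = P j ∧ not (Q j)

count-split : ∀ {K} (p q : Fin K → Bool) → count p ≡ count (p ∩ q) + count (p ∖ q)
count-split p q =
  ≡.trans (sum-cong-≗ λ i → split (p i) (q i)) (∑-distrib-+ (indicator ∘ (p ∩ q)) (indicator ∘ (p ∖ q)))
  where
  split : ∀ a b → indicator a ≡ indicator (a ∧ b) + indicator (a ∧ not b)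
  split false _     = ≡.refl
  split true  true  = ≡.refl
  split true  false = ≡.refl

count-∨ : ∀ {K} (p q : Fin K → Bool) → (∀ i → T (p i) → ¬ T (q i)) →
          count (λ i → p i ∨ q i) ≡ count p + count q
count-∨ p q disjoint = ≡.trans (sum-cong-≗ λ i → indicator-∨ (p i) (q i) (disjoint i))
                             (∑-distrib-+ (indicator ∘ p) (indicator ∘ q))
  where
  indicator-∨ : ∀ a b → (T a → ¬ T b) → indicator (a ∨ b) ≡ indicator a + indicator b
  indicator-∨ false _     _ = ≡.refl
  indicator-∨ true  false _ = ≡.refl
  indicator-∨ true  true  d = ⊥-elim (d _ _)

count-false : ∀ K → count {K} (λ _ → false) ≡ 0
count-false = sum-replicate-zero

count-true : ∀ K → count {K} (λ _ → true) ≡ K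
count-true zero    = ≡.refl
count-true (suc K) = cong suc (count-true K)

count-empty : ∀ {K} (p : Fin K → Bool) → (∀ i → ¬ T (p i)) → count p ≡ 0
count-empty {K} p empty = ≡.trans (count-cong (λ i → ¬T⇒false (empty i))) (count-false K)
  where
  ¬T⇒false : ∀ {b} → ¬ T b → b ≡ false
  ¬T⇒false {false} _ = ≡.refl
  ¬T⇒false {true}  ¬t = ⊥-elim (¬t _)

count-≡ : ∀ {K} (a : Fin K) → count (λ i → does (i ≟ a)) ≡ 1
count-≡ {suc K} a = begin
  count (λ i → does (i ≟ a))
    ≡⟨ sum-remove {i = a} (λ i → indicator (does (i ≟ a))) ⟩
  indicator (does (a ≟ a)) + ∑[ j < K ] indicator (does (punchIn a j ≟ a))
    ≡⟨ cong₂ _+_ (cong indicator (dec-true (a ≟ a) ≡.refl)) count-punchIn≡a ⟩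
  1 ∎
  where
  open ≡-Reasoning
  count-punchIn≡a : count (λ j → does (punchIn a j ≟ a)) ≡ 0
  count-punchIn≡a = ≡.trans (count-cong λ j → dec-false (punchIn a j ≟ a) (punchInᵢ≢i a j)) (count-false K)

T-∖ : ∀ {a b} → T (a ∧ not b) → T a × ¬ T b
T-∖ {true} {false} _ = _ , λ ()

∖-T : ∀ {a b} → T a → ¬ T b → T (a ∧ not b)
∖-T {true} {false} _ _  = _
∖-T {true} {true}  _ ¬b = ¬b _

∧-absorbˡ : ∀ {a b} → (T b → T a) → a ∧ b ≡ b
∧-absorbˡ {true}  {b}     _   = ≡.refl
∧-absorbˡ {false} {false} _   = ≡.refl
∧-absorbˡ {false} {true}  b⇒a = ⊥-elim (b⇒a _)

∖-∩-disjoint : ∀ {a b c} → (T c → ¬ T b) → (a ∧ not b) ∧ c ≡ a ∧ c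
∖-∩-disjoint {false}                _    = ≡.refl
∖-∩-disjoint {true} {false}         _    = ≡.refl
∖-∩-disjoint {true} {true}  {false} _    = ≡.refl
∖-∩-disjoint {true} {true}  {true}  c⇒¬b = ⊥-elim (c⇒¬b _ _)

module Order5Permutation {K : ℕ} (σ : Fin K → Fin K)
                         (σ⁵≗id : ∀ i → σ (σ (σ (σ (σ i)))) ≡ i) where

  σ^ : ℕ → Fin K → Fin K
  σ^ zero    i = i
  σ^ (suc k) i = σ (σ^ k i)

  σ^-+ : ∀ a b i → σ^ (a + b) i ≡ σ^ a (σ^ b i)
  σ^-+ zero    b i = ≡.refl
  σ^-+ (suc a) b i = cong σ (σ^-+ a b i)

  σ^-*5 : ∀ l i → σ^ (l * 5) i ≡ i
  σ^-*5 zero    i = ≡.refl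
  σ^-*5 (suc l) i = ≡.trans (σ^-+ 5 (l * 5) i) (≡.trans (cong (σ^ 5) (σ^-*5 l i)) (σ⁵≗id i))

  σ^-* : ∀ m {k i} → σ^ k i ≡ i → σ^ (m * k) i ≡ i
  σ^-* zero    _ = ≡.refl
  σ^-* (suc m) {k} {i} σᵏi≡i =
    ≡.trans (σ^-+ k (m * k) i) (≡.trans (cong (σ^ k) (σ^-* m σᵏi≡i)) σᵏi≡i)

  σ^-σ : ∀ a i → σ (σ^ a i) ≡ σ^ a (σ i)
  σ^-σ zero    i = ≡.refl
  σ^-σ (suc a) i = cong σ (σ^-σ a i)

  σ-injective : ∀ {i j} → σ i ≡ σ j → i ≡ j
  σ-injective {i} {j} σi≡σj = ≡.trans (≡.sym (σ⁵≗id i)) (≡.trans (cong (σ^ 4) σi≡σj) (σ⁵≗id j))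

  σ^-injective : ∀ k {i j} → σ^ k i ≡ σ^ k j → i ≡ j
  σ^-injective zero    e = e
  σ^-injective (suc k) e = σ^-injective k (σ-injective e)

  periodic⇒fixed : ∀ {d i} → 0 < d → d < 5 → σ^ d i ≡ i → σ i ≡ i
  periodic⇒fixed {d} {i} 0<d d<5 σᵈi≡i with invertible-mod-5 0<d d<5
  ... | m , l , md≡1+5l = begin
    σ i               ≡⟨ cong σ (σ^-*5 l i) ⟨
    σ^ (1 + l * 5) i  ≡⟨ cong (λ k → σ^ k i) md≡1+5l ⟨
    σ^ (m * d) i      ≡⟨ σ^-* m σᵈi≡i ⟩
    i                 ∎
    where open ≡-Reasoning

  orbit-injective : ∀ {i a b} → σ i ≢ i → a < b → b < 5 → σ^ a i ≢ σ^ b i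
  orbit-injective {i} {a} {b} σi≢i a<b b<5 σᵃi≡σᵇi =
    σi≢i (σ^-injective a (≡.trans (≡.sym (σ^-σ a i)) σy≡y))
    where
    y = σ^ a i
    σᵇ⁻ᵃy≡y : σ^ (b ∸ a) y ≡ y
    σᵇ⁻ᵃy≡y = ≡.trans (≡.sym (σ^-+ (b ∸ a) a i))
                    (≡.trans (cong (λ k → σ^ k i) (m∸n+n≡m (<⇒≤ a<b))) (≡.sym σᵃi≡σᵇi))
    σy≡y : σ y ≡ y
    σy≡y = periodic⇒fixed (m<n⇒0<n∸m a<b) (≤-<-trans (m∸n≤m b a) b<5) σᵇ⁻ᵃy≡y

  orbit : ℕ → Fin K → Fin K → Bool
  orbit zero    i j = false
  orbit (suc m) i j = does (j ≟ σ^ m i) ∨ orbit m i j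

  orbit-sound : ∀ m {i j} → T (orbit m i j) → ∃ λ k → k < m × j ≡ σ^ k i
  orbit-sound (suc m) {i} {j} j∈orbit with j ≟ σ^ m i
  ... | yes j≡σᵐi = m , ≤-refl , j≡σᵐi
  ... | no  _
    with k , k<m , j≡σᵏi ← orbit-sound m {i} {j} j∈orbit = k , m<n⇒m<1+n k<m , j≡σᵏi

  orbit-complete : ∀ m k i → k < m → T (orbit m i (σ^ k i))
  orbit-complete (suc m) k i k<1+m with σ^ k i ≟ σ^ m i
  ... | yes _        = _
  ... | no  σᵏi≢σᵐi = orbit-complete m k i (≤∧≢⇒< (≤-pred k<1+m) (σᵏi≢σᵐi ∘ cong (λ k → σ^ k i)))

  count-orbit : ∀ {i} → σ i ≢ i → ∀ m → m ≤ 5 → count (orbit m i) ≡ m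
  count-orbit σi≢i zero    _ = count-false K
  count-orbit {i} σi≢i (suc m) 1+m≤5 = begin
    count (orbit (suc m) i)                                ≡⟨ count-∨ _ _ disjoint ⟩
    count (λ j → does (j ≟ σ^ m i)) + count (orbit m i)    ≡⟨ cong₂ _+_ (count-≡ (σ^ m i)) count-orbitₘ ⟩
    suc m                                                  ∎
    where
    open ≡-Reasoning
    count-orbitₘ = count-orbit σi≢i m (≤-trans (n≤1+n m) 1+m≤5)
    disjoint : ∀ j → T (does (j ≟ σ^ m i)) → ¬ T (orbit m i j)
    disjoint j j≡σᵐi j∈orbit with j ≟ σ^ m i
    ... | yes j≡σᵐi with k , k<m , j≡σᵏi ← orbit-sound m {i} {j} j∈orbit =
      orbit-injective σi≢i k<m 1+m≤5 (≡.trans (≡.sym j≡σᵏi) j≡σᵐi)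

  Orbit : Fin K → Fin K → Bool
  Orbit = orbit 5

  Closed : (Fin K → Bool) → Set
  Closed P = ∀ j → T (P j) → T (P (σ j))

  Orbit-closed : ∀ i → Closed (Orbit i)
  Orbit-closed i j j∈Orbit with k , k<5 , ≡.refl ← orbit-sound 5 {i} {j} j∈Orbit with suc k ≟ℕ 5
  ... | yes 1+k≡5 = subst (T ∘ Orbit i) i≡σ¹⁺ᵏi (orbit-complete 5 0 i (s≤s z≤n))
    where
    i≡σ¹⁺ᵏi : i ≡ σ^ (suc k) i
    i≡σ¹⁺ᵏi = ≡.trans (≡.sym (σ⁵≗id i)) (cong (λ k → σ^ k i) (≡.sym 1+k≡5))
  ... | no  1+k≢5 = orbit-complete 5 (suc k) i (≤∧≢⇒< k<5 1+k≢5)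

  closed-σ^ : ∀ {P} → Closed P → ∀ k i → T (P i) → T (P (σ^ k i))
  closed-σ^ closed zero    i i∈P = i∈P
  closed-σ^ closed (suc k) i i∈P = closed (σ^ k i) (closed-σ^ closed k i i∈P)

  closed-σ⁻¹ : ∀ {P} → Closed P → ∀ j → T (P (σ j)) → T (P j)
  closed-σ⁻¹ {P} closed j σj∈P = subst (T ∘ P) (σ⁵≗id j) (closed-σ^ closed 4 (σ j) σj∈P)

  Orbit-unfixed : ∀ {i j} → σ i ≢ i → T (Orbit i j) → σ j ≢ j
  Orbit-unfixed {i} {j} σi≢i j∈Orbit with k , _ , ≡.refl ← orbit-sound 5 {i} {j} j∈Orbit =
    σi≢i ∘ σ^-injective k ∘ ≡.trans (≡.sym (σ^-σ k i))

  Fixed : Fin K → Bool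
  Fixed j = does (σ j ≟ j)

  Orbit⊆closed : ∀ {P} → Closed P → ∀ {x} → T (P x) → ∀ j → T (Orbit x j) → T (P j)
  Orbit⊆closed closed {x} x∈P j j∈Orbit with k , _ , ≡.refl ← orbit-sound 5 {x} {j} j∈Orbit =
    closed-σ^ closed k x x∈P

  module _ {P : Fin K → Bool} (closed : Closed P) {x : Fin K} (x∈P : T (P x)) (σx≢x : σ x ≢ x) where

    count-minus-Orbit : count P ≡ 5 + count (P ∖ Orbit x)
    count-minus-Orbit = begin
      count P                                        ≡⟨ count-split P (Orbit x) ⟩
      count (P ∩ Orbit x) + count (P ∖ Orbit x)     ≡⟨ cong (_+ count (P ∖ Orbit x)) count-P∩Orbit ⟩
      5 + count (P ∖ Orbit x)                        ∎
      where
      open ≡-Reasoning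
      count-P∩Orbit : count (P ∩ Orbit x) ≡ 5
      count-P∩Orbit =
        ≡.trans (count-cong (λ j → ∧-absorbˡ (Orbit⊆closed closed x∈P j))) (count-orbit σx≢x 5 ≤-refl)

    minus-Orbit-closed : Closed (P ∖ Orbit x)
    minus-Orbit-closed j j∈P∖Orbit with j∈P , j∉Orbit ← T-∖ {P j} {Orbit x j} j∈P∖Orbit =
      ∖-T (closed j j∈P) (j∉Orbit ∘ closed-σ⁻¹ (Orbit-closed x) j)

    minus-Orbit-∩-Fixed : (P ∖ Orbit x) ∩ Fixed ≗ P ∩ Fixed
    minus-Orbit-∩-Fixed j = ∖-∩-disjoint (λ j∈Fixed j∈Orbit → Orbit-unfixed σx≢x j∈Orbit (fixed j∈Fixed))
      where
      fixed : T (Fixed j) → σ j ≡ j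
      fixed j∈Fixed with σ j ≟ j
      ... | yes σj≡j = σj≡j

  -- Removes the five-element orbits of unfixed points one by one; F is fuel bounding count P.
  closed-count≡fixed-mod-5 : ∀ F P → count P ≤ F → Closed P →
                             ∃ λ q → count P ≡ count (P ∩ Fixed) + q * 5
  closed-count≡fixed-mod-5 F P count≤F closed with any? (λ j → T? (P j) ×-dec ¬? (σ j ≟ j))
  ... | no all-fixed =
    0 , ≡.trans (count-split P Fixed) (cong (count (P ∩ Fixed) +_) (count-empty (P ∖ Fixed) unfixed∉P))
    where
    unfixed∉P : ∀ j → ¬ T ((P ∖ Fixed) j)
    unfixed∉P j j∈P∖Fixed with j∈P , j∉Fixed ← T-∖ {P j} {Fixed j} j∈P∖Fixed with σ j ≟ j
    ... | no σj≢j = all-fixed (j , j∈P , σj≢j)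
    ... | yes _   = j∉Fixed _
  closed-count≡fixed-mod-5 zero    P count≤0 closed | yes (x , x∈P , σx≢x)
    with () ← subst (_≤ 0) (count-minus-Orbit closed x∈P σx≢x) count≤0
  closed-count≡fixed-mod-5 (suc F) P count≤1+F closed | yes (x , x∈P , σx≢x) =
    step (closed-count≡fixed-mod-5 F (P ∖ Orbit x) count′≤F (minus-Orbit-closed closed x∈P σx≢x))
    where
    open ≡-Reasoning
    count′≤F : count (P ∖ Orbit x) ≤ F
    count′≤F =
      ≤-trans (m≤n+m _ 4) (≤-pred (subst (_≤ suc F) (count-minus-Orbit closed x∈P σx≢x) count≤1+F))
    step : ∃ (λ q → count (P ∖ Orbit x) ≡ count ((P ∖ Orbit x) ∩ Fixed) + q * 5) →
           ∃ (λ q → count P ≡ count (P ∩ Fixed) + q * 5)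
    step (q , count≡) = suc q , (begin
      count P                                            ≡⟨ count-minus-Orbit closed x∈P σx≢x ⟩
      5 + count (P ∖ Orbit x)                            ≡⟨ cong (5 +_) count≡ ⟩
      5 + (count ((P ∖ Orbit x) ∩ Fixed) + q * 5)
        ≡⟨ cong (λ c → 5 + (c + q * 5)) (count-cong (minus-Orbit-∩-Fixed closed x∈P σx≢x)) ⟩
      5 + (count (P ∩ Fixed) + q * 5)                    ≡⟨ x∙yz≈y∙xz 5 _ _ ⟩
      count (P ∩ Fixed) + suc q * 5                      ∎)

  card≡fixed-mod-5 : ∃ λ q → K ≡ count Fixed + q * 5
  card≡fixed-mod-5
    with q , count≡ ← closed-count≡fixed-mod-5 K (λ _ → true) (≤-reflexive (count-true K)) (λ _ _ → _) =
    q , ≡.trans (≡.sym (count-true K)) count≡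

module _ {a} {A : Set a} {K : ℕ} (e : Fin K ↔ A) (ρ : A → A)
         (ρ⁵≗id : ∀ t → ρ (ρ (ρ (ρ (ρ t)))) ≡ t)
         {t₀ : A} (ρt₀≡t₀ : ρ t₀ ≡ t₀) (fixed⇒≡t₀ : ∀ t → ρ t ≡ t → t ≡ t₀) where

  open Inverse e
  open ≡-Reasoning

  private
    σ : Fin K → Fin K
    σ = from ∘ ρ ∘ to

    σ-from : ∀ t → σ (from t) ≡ from (ρ t)
    σ-from t = cong (from ∘ ρ) (strictlyInverseˡ t)

    σ⁵≗id : ∀ i → σ (σ (σ (σ (σ i)))) ≡ i
    σ⁵≗id i = begin
      σ (σ (σ (σ (σ i))))                    ≡⟨ cong (σ ∘ σ ∘ σ ∘ σ ∘ σ) (strictlyInverseʳ i) ⟨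
      σ (σ (σ (σ (σ (from t)))))             ≡⟨ cong (σ ∘ σ ∘ σ ∘ σ) (σ-from t) ⟩
      σ (σ (σ (σ (from (ρ t)))))             ≡⟨ cong (σ ∘ σ ∘ σ) (σ-from _) ⟩
      σ (σ (σ (from (ρ (ρ t)))))             ≡⟨ cong (σ ∘ σ) (σ-from _) ⟩
      σ (σ (from (ρ (ρ (ρ t)))))             ≡⟨ cong σ (σ-from _) ⟩
      σ (from (ρ (ρ (ρ (ρ t)))))             ≡⟨ σ-from _ ⟩
      from (ρ (ρ (ρ (ρ (ρ t)))))             ≡⟨ cong from (ρ⁵≗id t) ⟩
      from t                                 ≡⟨ strictlyInverseʳ i ⟩
      i                                      ∎
      where t = to i

    from-t₀⇔fixed : ∀ j → j ≡ from t₀ ⇔ σ j ≡ j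
    from-t₀⇔fixed j = mk⇔ (λ { ≡.refl → ≡.trans (σ-from t₀) (cong from ρt₀≡t₀) }) fixed⇒
      where
      fixed⇒ : σ j ≡ j → j ≡ from t₀
      fixed⇒ σj≡j = begin
        j             ≡⟨ strictlyInverseʳ j ⟨
        from (to j)   ≡⟨ cong from (fixed⇒≡t₀ (to j) ρ[to-j]≡to-j) ⟩
        from t₀       ∎
        where
        ρ[to-j]≡to-j : ρ (to j) ≡ to j
        ρ[to-j]≡to-j = ≡.trans (≡.sym (strictlyInverseˡ _)) (cong to σj≡j)

  unique-fixed-point⇒5∤card : ¬ 5 ∣ K
  unique-fixed-point⇒5∤card 5∣K = contradiction (∣1⇒≡1 5∣1) λ ()
    where
    open Order5Permutation σ σ⁵≗id using (Fixed; card≡fixed-mod-5)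
    q = proj₁ card≡fixed-mod-5
    count-Fixed : count Fixed ≡ 1
    count-Fixed = ≡.trans (count-cong λ j → does-≡ (σ j ≟ j) (Dec.map (from-t₀⇔fixed j) (j ≟ from t₀)))
                          (count-≡ (from t₀))
    K≡q*5+1 : K ≡ q * 5 + 1
    K≡q*5+1 = ≡.trans (proj₂ card≡fixed-mod-5) (≡.trans (cong (_+ q * 5) count-Fixed) (+-comm 1 (q * 5)))
    5∣1 : 5 ∣ 1
    5∣1 = ∣m+n∣m⇒∣n (subst (5 ∣_) K≡q*5+1 5∣K) (n∣m*n q)

module GroupProperties {c ℓ} (G : Group c ℓ) where

  open Group G
  open import Algebra.Properties.Group G public
  open import Algebra.Properties.Monoid.Mult monoid using (×-congʳ; ×-homo-+; ×-assocˡ) renaming (_×_ to _·_)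
  open import Algebra.Solver.Monoid monoid using (solve; _⊜_; _⊕_)
  open import Relation.Binary.Reasoning.Setoid setoid

  pow≡· : ∀ x k → pow G x k ≡ k · x
  pow≡· x zero    = ≡.refl
  pow≡· x (suc k) = cong (x ∙_) (pow≡· x k)

  pow-cong : ∀ k {x y} → x ≈ y → pow G x k ≈ pow G y k
  pow-cong k {x} {y} x≈y rewrite pow≡· x k | pow≡· y k = ×-congʳ k x≈y

  pow-+ : ∀ x m n → pow G x (m + n) ≈ pow G x m ∙ pow G x n
  pow-+ x m n rewrite pow≡· x (m + n) | pow≡· x m | pow≡· x n = ×-homo-+ x m n

  pow-* : ∀ x m n → pow G x (m * n) ≈ pow G (pow G x n) m
  pow-* x m n rewrite pow≡· x (m * n) | pow≡· (pow G x n) m | pow≡· x n = sym (×-assocˡ x m n)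

  pow-ε : ∀ k → pow G ε k ≈ ε
  pow-ε zero    = refl
  pow-ε (suc k) = trans (identityˡ _) (pow-ε k)

  pow-\\ : ∀ x {i j} → i ≤ j → pow G x i \\ pow G x j ≈ pow G x (j ∸ i)
  pow-\\ x {i} {j} i≤j = begin
    pow G x i \\ pow G x j                        ≡⟨ cong (λ k → pow G x i \\ pow G x k) (m+[n∸m]≡n i≤j) ⟨
    pow G x i \\ pow G x (i + (j ∸ i))            ≈⟨ ∙-congˡ (pow-+ x i (j ∸ i)) ⟩
    pow G x i \\ (pow G x i ∙ pow G x (j ∸ i))    ≈⟨ \\-leftDividesʳ _ _ ⟩
    pow G x (j ∸ i)                               ∎

  ∙≈ε-comm : ∀ {x y} → x ∙ y ≈ ε → y ∙ x ≈ ε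
  ∙≈ε-comm {x} {y} xy≈ε = trans (∙-congʳ (inverseʳ-unique x y xy≈ε)) (inverseˡ x)

  ∙≈ε⇒comm : ∀ {x y} → x ∙ y ≈ ε → x ∙ y ≈ y ∙ x
  ∙≈ε⇒comm xy≈ε = trans xy≈ε (sym (∙≈ε-comm xy≈ε))

  ≈ε⇒comm : ∀ {x} y → x ≈ ε → x ∙ y ≈ y ∙ x
  ≈ε⇒comm y x≈ε = trans (∙-congʳ x≈ε) (trans (identityˡ y) (trans (sym (identityʳ y)) (∙-congˡ (sym x≈ε))))

  ≈⇒\\≈ε : ∀ {x y} → x ≈ y → x \\ y ≈ ε
  ≈⇒\\≈ε {x} x≈y = trans (∙-congˡ (sym x≈y)) (inverseˡ x)

  ∙≈∙⇒\\≈// : ∀ {x y a b} → x ∙ a ≈ y ∙ b → x \\ y ≈ a // b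
  ∙≈∙⇒\\≈// {x} {y} {a} {b} xa≈yb = begin
    x \\ y              ≈⟨ ∙-congˡ (//-rightDividesʳ b y) ⟨
    x \\ (y ∙ b // b)   ≈⟨ ∙-congˡ (∙-congʳ xa≈yb) ⟨
    x \\ (x ∙ a // b)   ≈⟨ ∙-congˡ (assoc x a (b ⁻¹)) ⟩
    x \\ (x ∙ (a // b)) ≈⟨ \\-leftDividesʳ x (a // b) ⟩
    a // b              ∎

  conj : Carrier → Carrier → Carrier
  conj g x = g ∙ x ∙ g ⁻¹

  conj-ε : ∀ g → conj g ε ≈ ε
  conj-ε g = trans (∙-congʳ (identityʳ g)) (inverseʳ g)

  conj-∙ : ∀ g x y → conj g (x ∙ y) ≈ conj g x ∙ conj g y
  conj-∙ g x y = begin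
    g ∙ (x ∙ y) ∙ g ⁻¹              ≈⟨ ∙-congʳ (∙-congˡ (∙-congʳ (//-rightDividesˡ g x))) ⟨
    g ∙ ((x // g) ∙ g ∙ y) ∙ g ⁻¹   ≈⟨ reassociate ⟩
    conj g x ∙ conj g y             ∎
    where
    reassociate = solve 4 (λ g x g⁻¹ y → (g ⊕ (((x ⊕ g⁻¹) ⊕ g) ⊕ y)) ⊕ g⁻¹
                                       ⊜ ((g ⊕ x) ⊕ g⁻¹) ⊕ ((g ⊕ y) ⊕ g⁻¹))
                          refl g x (g ⁻¹) y

  record IsSubgroup {p} (S : Carrier → Set p) : Set (c ⊔ ℓ ⊔ p) where
    field
      ∈-resp-≈ : ∀ {x y} → x ≈ y → S x → S y
      ε-∈      : S ε
      ∙-∈      : ∀ {x y} → S x → S y → S (x ∙ y)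
      ⁻¹-∈     : ∀ {x} → S x → S (x ⁻¹)

    pow-∈ : ∀ k {x} → S x → S (pow G x k)
    pow-∈ zero    _   = ε-∈
    pow-∈ (suc k) x∈S = ∙-∈ x∈S (pow-∈ k x∈S)

    -- w ≈ (wᵈ)ᵐ ∙ ((w⁵)ˡ)⁻¹, where m d = 1 + 5 l.
    pow-coprime⇒∈ : ∀ {d w} → 0 < d → d < 5 → S (pow G w 5) → S (pow G w d) → S w
    pow-coprime⇒∈ {d} {w} 0<d d<5 w⁵∈S wᵈ∈S with m , l , md≡1+l*5 ← invertible-mod-5 0<d d<5 =
      ∈-resp-≈ (//-rightDividesʳ y w) (∙-∈ wy∈S (⁻¹-∈ (pow-∈ l w⁵∈S)))
      where
      y = pow G (pow G w 5) l
      wy∈S : S (w ∙ y)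
      wy∈S = ∈-resp-≈ (begin
        pow G (pow G w d) m    ≈⟨ pow-* w m d ⟨
        pow G w (m * d)        ≡⟨ cong (pow G w) md≡1+l*5 ⟩
        w ∙ pow G w (l * 5)    ≈⟨ ∙-congˡ (pow-* w l 5) ⟩
        w ∙ y                  ∎) (pow-∈ m wᵈ∈S)

    pow-\\⇒∈ : ∀ {i j w} → i < j → j < 5 → S (pow G w 5) → S (pow G w i \\ pow G w j) → S w
    pow-\\⇒∈ {i} {j} {w} i<j j<5 w⁵∈S wⁱ\\wʲ∈S =
      pow-coprime⇒∈ (m<n⇒0<n∸m i<j) (≤-<-trans (m∸n≤m j i) j<5) w⁵∈S
                    (∈-resp-≈ (pow-\\ w (<⇒≤ i<j)) wⁱ\\wʲ∈S)

  ≈ε-isSubgroup : IsSubgroup (_≈ ε)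
  ≈ε-isSubgroup = record
    { ∈-resp-≈ = λ x≈y x≈ε → trans (sym x≈y) x≈ε
    ; ε-∈      = refl
    ; ∙-∈      = λ x≈ε y≈ε → trans (∙-cong x≈ε y≈ε) (identityˡ ε)
    ; ⁻¹-∈     = λ x≈ε → trans (⁻¹-cong x≈ε) ε⁻¹≈ε
    }

  Centralizer : Carrier → Carrier → Set ℓ
  Centralizer h g = g ∙ h ≈ h ∙ g

  centralizer-isSubgroup : ∀ h → IsSubgroup (Centralizer h)
  centralizer-isSubgroup h = record
    { ∈-resp-≈ = λ g≈g′ gh≈hg → trans (∙-congʳ (sym g≈g′)) (trans gh≈hg (∙-congˡ g≈g′))
    ; ε-∈      = trans (identityˡ h) (sym (identityʳ h))
    ; ∙-∈      = λ {g} {g′} gh≈hg g′h≈hg′ → begin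
        g ∙ g′ ∙ h      ≈⟨ assoc g g′ h ⟩
        g ∙ (g′ ∙ h)    ≈⟨ ∙-congˡ g′h≈hg′ ⟩
        g ∙ (h ∙ g′)    ≈⟨ assoc g h g′ ⟨
        g ∙ h ∙ g′      ≈⟨ ∙-congʳ gh≈hg ⟩
        h ∙ g ∙ g′      ≈⟨ assoc h g g′ ⟩
        h ∙ (g ∙ g′)    ∎
    ; ⁻¹-∈     = λ {g} gh≈hg → begin
        g ⁻¹ ∙ h                  ≈⟨ //-rightDividesʳ g (g ⁻¹ ∙ h) ⟨
        g ⁻¹ ∙ h ∙ g // g         ≈⟨ ∙-congʳ (assoc (g ⁻¹) h g) ⟩
        (g \\ (h ∙ g)) // g       ≈⟨ ∙-congʳ (∙-congˡ gh≈hg) ⟨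
        (g \\ (g ∙ h)) // g       ≈⟨ ∙-congʳ (\\-leftDividesʳ g h) ⟩
        h ∙ g ⁻¹                  ∎
    }

  conj≈⇒\\∈Centralizer : ∀ {g g′ h} → conj g h ≈ conj g′ h → Centralizer h (g \\ g′)
  conj≈⇒\\∈Centralizer {g} {g′} {h} ghg⁻¹≈g′hg′⁻¹ = begin
    (g \\ g′) ∙ h              ≈⟨ assoc (g ⁻¹) g′ h ⟩
    g \\ (g′ ∙ h)              ≈⟨ ∙-congˡ (//-rightDividesˡ g′ (g′ ∙ h)) ⟨
    g \\ (conj g′ h ∙ g′)      ≈⟨ ∙-congˡ (∙-congʳ ghg⁻¹≈g′hg′⁻¹) ⟨
    g \\ (conj g h ∙ g′)       ≈⟨ assoc (g ⁻¹) (conj g h) g′ ⟨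
    (g \\ conj g h) ∙ g′       ≈⟨ ∙-congʳ (∙-congˡ (assoc g h (g ⁻¹))) ⟩
    (g \\ (g ∙ (h // g))) ∙ g′ ≈⟨ ∙-congʳ (\\-leftDividesʳ g (h // g)) ⟩
    h ∙ g ⁻¹ ∙ g′              ≈⟨ assoc h (g ⁻¹) g′ ⟩
    h ∙ (g \\ g′)              ∎

  products : Carrier → Carrier → Vector Carrier 5
  products x y = ε ∷ x ∷ y ∷ x ∙ y ∷ y ∙ x ∷ []

  products-collide⇒comm : ∀ x y {i j} → i Fin.< j → products x y i ≈ products x y j → x ∙ y ≈ y ∙ x
  products-collide⇒comm x y {0F} {1F} _ ε≈x    = ≈ε⇒comm y (sym ε≈x)
  products-collide⇒comm x y {0F} {2F} _ ε≈y    = sym (≈ε⇒comm x (sym ε≈y))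
  products-collide⇒comm x y {0F} {3F} _ ε≈xy   = ∙≈ε⇒comm (sym ε≈xy)
  products-collide⇒comm x y {0F} {4F} _ ε≈yx   = sym (∙≈ε⇒comm (sym ε≈yx))
  products-collide⇒comm x y {1F} {2F} _ x≈y    = trans (∙-congʳ x≈y) (∙-congˡ (sym x≈y))
  products-collide⇒comm x y {1F} {3F} _ x≈xy   = sym (≈ε⇒comm x (identityʳ-unique x y (sym x≈xy)))
  products-collide⇒comm x y {1F} {4F} _ x≈yx   = sym (≈ε⇒comm x (identityˡ-unique y x (sym x≈yx)))
  products-collide⇒comm x y {2F} {3F} _ y≈xy   = ≈ε⇒comm y (identityˡ-unique x y (sym y≈xy))
  products-collide⇒comm x y {2F} {4F} _ y≈yx   = ≈ε⇒comm y (identityʳ-unique y x (sym y≈yx))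
  products-collide⇒comm x y {3F} {4F} _ xy≈yx  = xy≈yx
  products-collide⇒comm x y {_}                 {0F} ()
  products-collide⇒comm x y {suc _}             {1F} (s≤s ())
  products-collide⇒comm x y {suc (suc _)}       {2F} (s≤s (s≤s ()))
  products-collide⇒comm x y {suc (suc (suc _))} {3F} (s≤s (s≤s (s≤s ())))
  products-collide⇒comm x y {4F}                {4F} (s≤s (s≤s (s≤s (s≤s ()))))

  commutative⇒[,]≈ε : (∀ x y → x ∙ y ≈ y ∙ x) → ∀ a b → [_,_] G a b ≈ ε
  commutative⇒[,]≈ε comm a b = begin
    a ⁻¹ ∙ b ⁻¹ ∙ a ∙ b   ≈⟨ ∙-congʳ (∙-congʳ (comm (a ⁻¹) (b ⁻¹))) ⟩
    b ⁻¹ ∙ a ⁻¹ ∙ a ∙ b   ≈⟨ ∙-congʳ (//-rightDividesˡ a (b ⁻¹)) ⟩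
    b ⁻¹ ∙ b              ≈⟨ inverseˡ b ⟩
    ε                     ∎

module _ {c₁ ℓ₁ c₂ ℓ₂} {G : Group c₁ ℓ₁} {H : Group c₂ ℓ₂} where
  private
    module G = Group G
    module H = Group H

  pow-homomorphic : (f : G.Carrier → H.Carrier) → f G.ε H.≈ H.ε →
                    (∀ x y → f (x G.∙ y) H.≈ f x H.∙ f y) →
                    ∀ x k → f (pow G x k) H.≈ pow H (f x) k
  pow-homomorphic f f-ε f-∙ x zero    = f-ε
  pow-homomorphic f f-ε f-∙ x (suc k) =
    H.trans (f-∙ x (pow G x k)) (H.∙-congˡ (pow-homomorphic f f-ε f-∙ x k))

module Cosets {c ℓ p} (G : Group c ℓ) {N : Group.Carrier G → Set p}
              (N-isSubgroup : GroupProperties.IsSubgroup G N) where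

  open Group G
  open GroupProperties G
  open IsSubgroup N-isSubgroup

  infix 4 _∼_
  _∼_ : Carrier → Carrier → Set p
  x ∼ y = N (x \\ y)

  ≈⇒∼ : ∀ {x y} → x ≈ y → x ∼ y
  ≈⇒∼ x≈y = ∈-resp-≈ (sym (≈⇒\\≈ε x≈y)) ε-∈

  ∼-sym : ∀ {x y} → x ∼ y → y ∼ x
  ∼-sym {x} {y} x∼y =
    ∈-resp-≈ (trans (⁻¹-anti-homo-∙ (x ⁻¹) y) (∙-congˡ (⁻¹-involutive x))) (⁻¹-∈ x∼y)

  ∼-trans : ∀ {x y z} → x ∼ y → y ∼ z → x ∼ z
  ∼-trans {x} {y} {z} x∼y y∼z =
    ∈-resp-≈ (trans (assoc (x ⁻¹) y (y \\ z)) (∙-congˡ (\\-leftDividesˡ y z))) (∙-∈ x∼y y∼z)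

  ∼ε⇒∈ : ∀ {x} → x ∼ ε → N x
  ∼ε⇒∈ {x} x∼ε = ∈-resp-≈ (trans (⁻¹-cong (identityʳ (x ⁻¹))) (⁻¹-involutive x)) (⁻¹-∈ x∼ε)

module Quotient {c ℓ p} (G : Group c ℓ) {N : Group.Carrier G → Set p}
                (N-isSubgroup : GroupProperties.IsSubgroup G N)
                (N-normal : ∀ g {x} → N x → N (GroupProperties.conj G g x)) where

  open Group G
  open GroupProperties G
  open import Algebra.Solver.Monoid monoid using (solve; _⊜_; _⊕_)
  open import Relation.Binary.Reasoning.Setoid setoid
  open IsSubgroup N-isSubgroup
  open Cosets G N-isSubgroup public

  ∙-cong-∼ : ∀ {x y u v} → x ∼ y → u ∼ v → x ∙ u ∼ y ∙ v
  ∙-cong-∼ {x} {y} {u} {v} x∼y u∼v = ∈-resp-≈ eq (∙-∈ (N-normal (u ⁻¹) x∼y) u∼v)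
    where
    eq : conj (u ⁻¹) (x \\ y) ∙ (u \\ v) ≈ (x ∙ u) \\ (y ∙ v)
    eq = begin
      u ⁻¹ ∙ (x ⁻¹ ∙ y) ∙ u ⁻¹ ⁻¹ ∙ (u ⁻¹ ∙ v)   ≈⟨ assoc _ _ _ ⟩
      u ⁻¹ ∙ (x ⁻¹ ∙ y) ∙ (u ⁻¹ \\ (u ⁻¹ ∙ v))   ≈⟨ ∙-congˡ (\\-leftDividesʳ (u ⁻¹) v) ⟩
      u ⁻¹ ∙ (x ⁻¹ ∙ y) ∙ v                      ≈⟨ reassociate ⟩
      u ⁻¹ ∙ x ⁻¹ ∙ (y ∙ v)                      ≈⟨ ∙-congʳ (⁻¹-anti-homo-∙ x u) ⟨
      (x ∙ u) \\ (y ∙ v)                         ∎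
      where
      reassociate = solve 4 (λ a b c d → (a ⊕ (b ⊕ c)) ⊕ d ⊜ (a ⊕ b) ⊕ (c ⊕ d)) refl (u ⁻¹) (x ⁻¹) y v

  ⁻¹-cong-∼ : ∀ {x y} → x ∼ y → x ⁻¹ ∼ y ⁻¹
  ⁻¹-cong-∼ {x} {y} x∼y = ∈-resp-≈ eq (N-normal x (∼-sym x∼y))
    where
    eq : conj x (y \\ x) ≈ x ⁻¹ \\ y ⁻¹
    eq = begin
      x ∙ (y ⁻¹ ∙ x) // x     ≈⟨ ∙-congʳ (assoc x (y ⁻¹) x) ⟨
      x ∙ y ⁻¹ ∙ x // x       ≈⟨ //-rightDividesʳ x (x ∙ y ⁻¹) ⟩
      x ∙ y ⁻¹                ≈⟨ ∙-congʳ (⁻¹-involutive x) ⟨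
      x ⁻¹ \\ y ⁻¹            ∎

  quotientGroup : Group c p
  quotientGroup = record
    { Carrier = Carrier
    ; _≈_     = _∼_
    ; _∙_     = _∙_
    ; ε       = ε
    ; _⁻¹     = _⁻¹
    ; isGroup = record
      { isMonoid = record
        { isSemigroup = record
          { isMagma = record
            { isEquivalence = record { refl = ≈⇒∼ refl ; sym = ∼-sym ; trans = ∼-trans }
            ; ∙-cong        = ∙-cong-∼
            }
          ; assoc = λ x y z → ≈⇒∼ (assoc x y z)
          }
        ; identity = (≈⇒∼ ∘ identityˡ) , (≈⇒∼ ∘ identityʳ)
        }
      ; inverse = (≈⇒∼ ∘ inverseˡ) , (≈⇒∼ ∘ inverseʳ)
      ; ⁻¹-cong = ⁻¹-cong-∼
      }
    }

  subgroup-of-quotient : ∀ {q} {S : Carrier → Set q} →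
                         GroupProperties.IsSubgroup quotientGroup S → IsSubgroup S
  subgroup-of-quotient S-isSubgroup = record
    { ∈-resp-≈ = λ x≈y → S.∈-resp-≈ (≈⇒∼ x≈y)
    ; ε-∈      = S.ε-∈
    ; ∙-∈      = S.∙-∈
    ; ⁻¹-∈     = S.⁻¹-∈
    }
    where module S = GroupProperties.IsSubgroup S-isSubgroup

module CyclicOfOrder5 {c ℓ} (G : Group c ℓ) {a : Group.Carrier G}
                      (a⁵≈ε : Group._≈_ G (pow G a 5) (Group.ε G)) where

  open Group G
  open GroupProperties G
  open import Relation.Binary.Reasoning.Setoid setoid
  private module Trivial = IsSubgroup ≈ε-isSubgroup

  ⟨a⟩ : Carrier → Set ℓ
  ⟨a⟩ x = ∃ λ (k : Fin 5) → x ≈ pow G a (toℕ k)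

  ⟨a⟩-resp-≈ : ∀ {x y} → x ≈ y → ⟨a⟩ x → ⟨a⟩ y
  ⟨a⟩-resp-≈ x≈y (k , x≈aᵏ) = k , trans (sym x≈y) x≈aᵏ

  pow-a-*5≈ε : ∀ k → pow G a (k * 5) ≈ ε
  pow-a-*5≈ε k = trans (pow-* a k 5) (trans (pow-cong k a⁵≈ε) (pow-ε k))

  pow-a-∈ : ∀ m → ⟨a⟩ (pow G a m)
  pow-a-∈ m = m mod 5 , (begin
    pow G a m                               ≡⟨ cong (pow G a) (m≡m%n+[m/n]*n m 5) ⟩
    pow G a (m % 5 + m / 5 * 5)             ≈⟨ pow-+ a (m % 5) (m / 5 * 5) ⟩
    pow G a (m % 5) ∙ pow G a (m / 5 * 5)   ≈⟨ ∙-congˡ (pow-a-*5≈ε (m / 5)) ⟩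
    pow G a (m % 5) ∙ ε                     ≈⟨ identityʳ _ ⟩
    pow G a (m % 5)                         ≡⟨ cong (pow G a) (toℕ-fromℕ< (m%n<n m 5)) ⟨
    pow G a (toℕ (m mod 5))                 ∎)

  ⟨a⟩-isSubgroup : IsSubgroup ⟨a⟩
  ⟨a⟩-isSubgroup = record
    { ∈-resp-≈ = ⟨a⟩-resp-≈
    ; ε-∈      = 0F , refl
    ; ∙-∈      = λ { (k , x≈aᵏ) (l , y≈aˡ) →
        ⟨a⟩-resp-≈ (sym (trans (∙-cong x≈aᵏ y≈aˡ) (sym (pow-+ a (toℕ k) (toℕ l)))))
                   (pow-a-∈ (toℕ k + toℕ l)) }
    ; ⁻¹-∈     = λ { (k , x≈aᵏ) →
        ⟨a⟩-resp-≈ (sym (trans (⁻¹-cong x≈aᵏ) (sym (inverse-pow (toℕ k))))) (pow-a-∈ (toℕ k * 4)) }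
    }
    where
    inverse-pow : ∀ k → pow G a (k * 4) ≈ pow G a k ⁻¹
    inverse-pow k = inverseʳ-unique (pow G a k) (pow G a (k * 4)) (begin
      pow G a k ∙ pow G a (k * 4)    ≈⟨ pow-+ a k (k * 4) ⟨
      pow G a (k + k * 4)            ≡⟨ cong (pow G a) (*-suc k 4) ⟨
      pow G a (k * 5)                ≈⟨ pow-a-*5≈ε k ⟩
      ε                              ∎)

  ∈⟨a⟩⇒pow5≈ε : ∀ {x} → ⟨a⟩ x → pow G x 5 ≈ ε
  ∈⟨a⟩⇒pow5≈ε {x} (k , x≈aᵏ) = begin
    pow G x 5                   ≈⟨ pow-cong 5 x≈aᵏ ⟩
    pow G (pow G a (toℕ k)) 5   ≈⟨ pow-* a 5 (toℕ k) ⟨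
    pow G a (5 * toℕ k)         ≡⟨ cong (pow G a) (*-comm 5 (toℕ k)) ⟩
    pow G a (toℕ k * 5)         ≈⟨ pow-a-*5≈ε (toℕ k) ⟩
    ε                           ∎

  pow-a-injective : ¬ a ≈ ε → ∀ {k l : Fin 5} → pow G a (toℕ k) ≈ pow G a (toℕ l) → k ≡ l
  pow-a-injective a≉ε {k} {l} aᵏ≈aˡ with <-cmp k l
  ... | tri< k<l _ _ = contradiction (Trivial.pow-\\⇒∈ k<l (toℕ<n l) a⁵≈ε (≈⇒\\≈ε aᵏ≈aˡ)) a≉ε
  ... | tri≈ _ k≡l _ = k≡l
  ... | tri> _ _ l<k = contradiction (Trivial.pow-\\⇒∈ l<k (toℕ<n k) a⁵≈ε (≈⇒\\≈ε (sym aᵏ≈aˡ))) a≉ε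

module FiniteGroup {c ℓ} (G : Group c ℓ) {n : ℕ} (ord : HasOrder G n) where

  open Group G
  open GroupProperties G
  open import Algebra.Solver.Monoid monoid using (solve; _⊜_; _⊕_; id)

  element : Fin n → Carrier
  element = proj₁ ord

  element-injective : ∀ {i j} → element i ≈ element j → i ≡ j
  element-injective = proj₁ (proj₂ ord) _ _

  index : Carrier → Fin n
  index x = proj₁ (proj₂ (proj₂ ord) x)

  element-index : ∀ x → element (index x) ≈ x
  element-index x = proj₂ (proj₂ (proj₂ ord) x)

  index-cong : ∀ {x y} → x ≈ y → index x ≡ index y
  index-cong {x} {y} x≈y = element-injective (trans (element-index x) (trans x≈y (sym (element-index y))))

  index-injective : ∀ {x y} → index x ≡ index y → x ≈ y
  index-injective {x} {y} eq =
    trans (sym (element-index x)) (trans (reflexive (cong element eq)) (element-index y))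

  ≈-dec : ∀ x y → Dec (x ≈ y)
  ≈-dec x y = Dec.map (mk⇔ index-injective index-cong) (index x ≟ index y)

  Quadruple : Set
  Quadruple = Fin n × Fin n × Fin n × Fin n

  quadruples↔ : Fin (n * (n * (n * n))) ↔ Quadruple
  quadruples↔ = ↔-trans *↔× (↔-refl ×-↔ ↔-trans *↔× (↔-refl ×-↔ *↔×))

  product : Quadruple → Carrier
  product (i , j , k , l) = element i ∙ element j ∙ element k ∙ element l

  Completes : Quadruple → Fin n → Set ℓ
  Completes q m = product q ∙ element m ≈ ε

  completion : Quadruple → Fin n
  completion q = index (product q ⁻¹)

  completes : ∀ q → Completes q (completion q)
  completes q = trans (∙-congˡ (element-index _)) (inverseʳ (product q))

  completion-unique : ∀ {q m} → Completes q m → completion q ≡ m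
  completion-unique qm≈ε = element-injective (trans (element-index _) (sym (inverseʳ-unique _ _ qm≈ε)))

  completes-rotate : ∀ {i j k l m} → Completes (i , j , k , l) m → Completes (j , k , l , m) i
  completes-rotate {i} {j} {k} {l} {m} ijklm≈ε = ∙≈ε-comm (trans reassociate ijklm≈ε)
    where
    reassociate : element i ∙ product (j , k , l , m) ≈ product (i , j , k , l) ∙ element m
    reassociate = solve 5 (λ a b c d e → a ⊕ (((b ⊕ c) ⊕ d) ⊕ e) ⊜ (((a ⊕ b) ⊕ c) ⊕ d) ⊕ e) refl
                          (element i) (element j) (element k) (element l) (element m)

  -- McKay: (x₁, x₂, x₃, x₄) stands for the 5-tuple completed by x₅ = (x₁x₂x₃x₄)⁻¹. Rotating
  -- that 5-tuple is a permutation of order 5 whose fixed points are the (x, …, x) with x⁵ = ε.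
  rotate : Quadruple → Quadruple
  rotate q@(_ , j , k , l) = j , k , l , completion q

  rotate-completes : ∀ {i j k l m} → Completes (i , j , k , l) m → rotate (i , j , k , l) ≡ (j , k , l , m)
  rotate-completes c = cong (λ m → _ , _ , _ , m) (completion-unique c)

  rotate⁵≗id : ∀ q → rotate (rotate (rotate (rotate (rotate q)))) ≡ q
  rotate⁵≗id q = ≡.trans (cong (rotate ∘ rotate ∘ rotate) (rotate-completes c₂))
                 (≡.trans (cong (rotate ∘ rotate) (rotate-completes c₃))
                 (≡.trans (cong rotate (rotate-completes c₄)) (rotate-completes c₅)))
    where
    c₂ = completes-rotate (completes q)
    c₃ = completes-rotate c₂
    c₄ = completes-rotate c₃
    c₅ = completes-rotate c₄

  module _ (no-order-5 : ∀ x → pow G x 5 ≈ ε → x ≈ ε) where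

    e : Fin n
    e = index ε

    element-e : element e ≈ ε
    element-e = element-index ε

    rotate-eeee : rotate (e , e , e , e) ≡ (e , e , e , e)
    rotate-eeee = rotate-completes (∙-∈ (∙-∈ (∙-∈ (∙-∈ element-e element-e) element-e) element-e) element-e)
      where open IsSubgroup ≈ε-isSubgroup using (∙-∈)

    rotate-fixed⇒eeee : ∀ q → rotate q ≡ q → q ≡ (e , e , e , e)
    rotate-fixed⇒eeee (i , j , k , l) rq≡q
      with ≡.refl ← cong proj₁ rq≡q
         | ≡.refl ← cong (proj₁ ∘ proj₂) rq≡q
         | ≡.refl ← cong (proj₁ ∘ proj₂ ∘ proj₂) rq≡q =
      cong (λ i → i , i , i , i) (element-injective (trans xᵢ≈ε (sym element-e)))
      where
      x = element i
      x⁵≈ε : pow G x 5 ≈ ε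
      x⁵≈ε = trans (solve 1 (λ x → x ⊕ (x ⊕ (x ⊕ (x ⊕ (x ⊕ id)))) ⊜ (((x ⊕ x) ⊕ x) ⊕ x) ⊕ x) refl x)
                   (subst (Completes (i , i , i , i)) (cong (proj₂ ∘ proj₂ ∘ proj₂) rq≡q) (completes _))
      xᵢ≈ε : x ≈ ε
      xᵢ≈ε = no-order-5 x x⁵≈ε

    no-order-5⇒5∤n : ¬ 5 ∣ n
    no-order-5⇒5∤n 5∣n =
      unique-fixed-point⇒5∤card quadruples↔ rotate rotate⁵≗id rotate-eeee rotate-fixed⇒eeee (∣m⇒∣m*n _ 5∣n)

  cauchy-5 : 5 ∣ n → ∃ λ a → ¬ a ≈ ε × pow G a 5 ≈ ε
  cauchy-5 5∣n with any? (λ i → ¬? (≈-dec (element i) ε) ×-dec ≈-dec (pow G (element i) 5) ε)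
  ... | yes (i , order-5) = element i , order-5
  ... | no  ∄order-5      = contradiction 5∣n (no-order-5⇒5∤n no-order-5)
    where
    no-order-5 : ∀ x → pow G x 5 ≈ ε → x ≈ ε
    no-order-5 x x⁵≈ε = decidable-stable (≈-dec x ε) λ x≉ε →
      ∄order-5 (index x , x≉ε ∘ trans (sym (element-index x)) , trans (pow-cong 5 (element-index x)) x⁵≈ε)

open RawGroup ℤ/5-rawGroup using () renaming (_∙_ to _+₅_; _⁻¹ to -₅_; rawMonoid to ℤ/5-rawMonoid)
open import Algebra.Definitions.RawMonoid ℤ/5-rawMonoid using () renaming (_×_ to _·₅_)

+₅-identityʳ : ∀ p → p +₅ 0F ≡ p
+₅-identityʳ 0F = ≡.refl
+₅-identityʳ 1F = ≡.refl
+₅-identityʳ 2F = ≡.refl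
+₅-identityʳ 3F = ≡.refl
+₅-identityʳ 4F = ≡.refl

+₅-inverseʳ : ∀ p → p +₅ -₅ p ≡ 0F
+₅-inverseʳ 0F = ≡.refl
+₅-inverseʳ 1F = ≡.refl
+₅-inverseʳ 2F = ≡.refl
+₅-inverseʳ 3F = ≡.refl
+₅-inverseʳ 4F = ≡.refl

5·₅p≡0 : ∀ p → 5 ·₅ p ≡ 0F
5·₅p≡0 0F = ≡.refl
5·₅p≡0 1F = ≡.refl
5·₅p≡0 2F = ≡.refl
5·₅p≡0 3F = ≡.refl
5·₅p≡0 4F = ≡.refl

p·₅1≡p : ∀ p → toℕ p ·₅ 1F ≡ p
p·₅1≡p 0F = ≡.refl
p·₅1≡p 1F = ≡.refl
p·₅1≡p 2F = ≡.refl
p·₅1≡p 3F = ≡.refl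
p·₅1≡p 4F = ≡.refl

module Extension {c₁ ℓ₁ c₂ ℓ₂} {H : Group c₁ ℓ₁} {Γ : Group c₂ ℓ₂} (E : IsExtensionℤ/5 H Γ) where

  open Group Γ
  open GroupProperties Γ
  open IsExtensionℤ/5 E
  private
    module H = Group H
    module π = IsGroupHomomorphism π-hom
    module ι = IsGroupMonomorphism ι-mono

  Ker : Carrier → Set
  Ker x = π x ≡ 0F

  Ker-isSubgroup : IsSubgroup Ker
  Ker-isSubgroup = record
    { ∈-resp-≈ = λ x≈y πx≡0 → ≡.trans (≡.sym (π.⟦⟧-cong x≈y)) πx≡0
    ; ε-∈      = π.ε-homo
    ; ∙-∈      = λ {x} {y} πx≡0 πy≡0 → ≡.trans (π.homo x y) (cong₂ _+₅_ πx≡0 πy≡0)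
    ; ⁻¹-∈     = λ {x} πx≡0 → ≡.trans (π.⁻¹-homo x) (cong -₅_ πx≡0)
    }

  Ker-conj : ∀ g {x} → Ker x → Ker (conj g x)
  Ker-conj g {x} πx≡0 = begin
    π (g ∙ x ∙ g ⁻¹)          ≡⟨ π.homo (g ∙ x) (g ⁻¹) ⟩
    π (g ∙ x) +₅ π (g ⁻¹)     ≡⟨ cong₂ _+₅_ (≡.trans (π.homo g x) (cong (π g +₅_) πx≡0)) (π.⁻¹-homo g) ⟩
    π g +₅ 0F +₅ -₅ π g       ≡⟨ cong (_+₅ -₅ π g) (+₅-identityʳ (π g)) ⟩
    π g +₅ -₅ π g             ≡⟨ +₅-inverseʳ (π g) ⟩
    0F                        ∎
    where open ≡-Reasoning

  π-pow : ∀ x k → π (pow Γ x k) ≡ k ·₅ π x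
  π-pow x zero    = π.ε-homo
  π-pow x (suc k) = ≡.trans (π.homo x (pow Γ x k)) (cong (π x +₅_) (π-pow x k))

  pow5∈Ker : ∀ g → Ker (pow Γ g 5)
  pow5∈Ker g = ≡.trans (π-pow g 5) (5·₅p≡0 (π g))

  ι∈Ker : ∀ h → Ker (ι h)
  ι∈Ker h = proj₂ (exact (ι h)) h refl

  Ker⇒ι : ∀ {x} → Ker x → ∃ λ h → ι h ≈ x
  Ker⇒ι {x} = proj₁ (exact x)

  ι-pow : ∀ h k → ι (pow H h k) ≈ pow Γ (ι h) k
  ι-pow = pow-homomorphic {G = H} {H = Γ} ι ι.ε-homo ι.∙-homo

  Ker-and-preimage-of-1-generate : ∀ {γ} → π γ ≡ 1F → ∀ {q} {S : Carrier → Set q} → IsSubgroup S →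
                                   (∀ {x} → Ker x → S x) → S γ → ∀ x → S x
  Ker-and-preimage-of-1-generate {γ} πγ≡1 S-isSubgroup Ker⊆S γ∈S x =
    ∈-resp-≈ (//-rightDividesˡ γᵏ x) (∙-∈ (Ker⊆S x//γᵏ∈Ker) (pow-∈ k γ∈S))
    where
    open IsSubgroup S-isSubgroup
    k = toℕ (π x)
    γᵏ = pow Γ γ k
    x//γᵏ∈Ker : Ker (x // γᵏ)
    x//γᵏ∈Ker = begin
      π (x ∙ γᵏ ⁻¹)          ≡⟨ π.homo x (γᵏ ⁻¹) ⟩
      π x +₅ π (γᵏ ⁻¹)       ≡⟨ cong (π x +₅_) (≡.trans (π.⁻¹-homo γᵏ) (cong -₅_ (π-pow γ k))) ⟩
      π x +₅ -₅ (k ·₅ π γ)   ≡⟨ cong (λ p → π x +₅ -₅ (k ·₅ p)) πγ≡1 ⟩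
      π x +₅ -₅ (k ·₅ 1F)    ≡⟨ cong (λ p → π x +₅ -₅ p) (p·₅1≡p (π x)) ⟩
      π x +₅ -₅ π x          ≡⟨ +₅-inverseʳ (π x) ⟩
      0F                     ∎
      where open ≡-Reasoning

module ModuloOrder5Subgroup
  {c₁ ℓ₁ c₂ ℓ₂} {H : Group c₁ ℓ₁} {Γ : Group c₂ ℓ₂} {n : ℕ} (ord : HasOrder H n) (E : IsExtensionℤ/5 H Γ)
  {a : Group.Carrier H} (a≉ε : ¬ Group._≈_ H a (Group.ε H)) (a⁵≈ε : Group._≈_ H (pow H a 5) (Group.ε H)) where

  open Group Γ
  open GroupProperties Γ
  open Extension E
  open IsExtensionℤ/5 E using (ι; ι-mono; π-surj)
  open FiniteGroup H ord using (element; element-injective; index; index-injective)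
  private
    module ι = IsGroupMonomorphism ι-mono
    module Ker = IsSubgroup Ker-isSubgroup

  α : Carrier
  α = ι a

  α⁵≈ε : pow Γ α 5 ≈ ε
  α⁵≈ε = trans (sym (ι-pow a 5)) (trans (ι.⟦⟧-cong a⁵≈ε) ι.ε-homo)

  α≉ε : ¬ α ≈ ε
  α≉ε α≈ε = a≉ε (ι.injective (trans α≈ε (sym ι.ε-homo)))

  open CyclicOfOrder5 Γ α⁵≈ε
    renaming (⟨a⟩ to N; ⟨a⟩-isSubgroup to N-isSubgroup; pow-a-∈ to pow-α-∈; ∈⟨a⟩⇒pow5≈ε to ∈N⇒pow5≈ε)
    using (pow-a-injective)
  open IsSubgroup N-isSubgroup
  open Cosets Γ N-isSubgroup

  N⊆Ker : ∀ {x} → N x → Ker x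
  N⊆Ker (k , x≈αᵏ) = Ker.∈-resp-≈ (sym x≈αᵏ) (Ker.pow-∈ (toℕ k) (ι∈Ker a))

  module _ (n<25 : n < 25) where

    -- The 25 elements u i ∙ αᵏ of ker π ≅ H cannot be pairwise distinct, as |H| < 25.
    at-most-four-cosets : (u : Fin 5 → Carrier) → (∀ i → Ker (u i)) → ∃₂ λ i j → i Fin.< j × u i ∼ u j
    at-most-four-cosets u u∈Ker = use-pigeonhole (pigeonhole n<25 (index ∘ preimage ∘ to))
      where
      open Inverse (*↔× {5} {5}) using (to)
      translate : Fin 5 × Fin 5 → Carrier
      translate (i , k) = u i ∙ pow Γ α (toℕ k)
      translate∈Ker : ∀ p → Ker (translate p)
      translate∈Ker (i , k) = Ker.∙-∈ (u∈Ker i) (N⊆Ker (pow-α-∈ (toℕ k)))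
      preimage : Fin 5 × Fin 5 → Group.Carrier H
      preimage p = proj₁ (Ker⇒ι (translate∈Ker p))
      index-preimage-injective : ∀ p q → index (preimage p) ≡ index (preimage q) → translate p ≈ translate q
      index-preimage-injective p q eq =
        trans (sym (proj₂ (Ker⇒ι (translate∈Ker p))))
              (trans (ι.⟦⟧-cong (index-injective eq)) (proj₂ (Ker⇒ι (translate∈Ker q))))
      same-coset : ∀ i k j l → translate (i , k) ≈ translate (j , l) → u i ∼ u j
      same-coset i k j l uᵢαᵏ≈uⱼαˡ =
        ∈-resp-≈ (sym (∙≈∙⇒\\≈// uᵢαᵏ≈uⱼαˡ)) (∙-∈ (pow-α-∈ (toℕ k)) (⁻¹-∈ (pow-α-∈ (toℕ l))))
      collision : ∀ p q → translate p ≈ translate q → p ≢ q → ∃₂ λ i j → i Fin.< j × u i ∼ u j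
      collision (i , k) (j , l) uᵢαᵏ≈uⱼαˡ ik≢jl with <-cmp i j
      ... | tri< i<j _ _    = i , j , i<j , same-coset i k j l uᵢαᵏ≈uⱼαˡ
      ... | tri≈ _ ≡.refl _ =
        contradiction (cong (i ,_) (pow-a-injective α≉ε (∙-cancelˡ (u i) _ _ uᵢαᵏ≈uⱼαˡ))) ik≢jl
      ... | tri> _ _ j<i    = j , i , j<i , ∼-sym (same-coset i k j l uᵢαᵏ≈uⱼαˡ)
      use-pigeonhole : (∃₂ λ c₁ c₂ → c₁ Fin.< c₂ × index (preimage (to c₁)) ≡ index (preimage (to c₂))) →
                       ∃₂ λ i j → i Fin.< j × u i ∼ u j
      use-pigeonhole (c₁ , c₂ , c₁<c₂ , eq) =
        collision (to c₁) (to c₂) (index-preimage-injective (to c₁) (to c₂) eq)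
                  (λ to≡to → <-irrefl (Injection.injective (↔⇒↣ *↔×) to≡to) c₁<c₂)

    pow5∈N⇒∈N : ∀ {w} → Ker w → N (pow Γ w 5) → N w
    pow5∈N⇒∈N {w} w∈Ker w⁵∈N =
      use (at-most-four-cosets (λ i → pow Γ w (toℕ i)) (λ i → Ker.pow-∈ (toℕ i) w∈Ker))
      where
      use : (∃₂ λ i j → i Fin.< j × pow Γ w (toℕ i) ∼ pow Γ w (toℕ j)) → N w
      use (i , j , i<j , wⁱ∼wʲ) = pow-\\⇒∈ {toℕ i} {toℕ j} {w} i<j (toℕ<n j) w⁵∈N wⁱ∼wʲ

    N-normal : ∀ g {x} → N x → N (conj g x)
    N-normal g {x} x∈N = pow5∈N⇒∈N (Ker-conj g (N⊆Ker x∈N)) (∈-resp-≈ (sym conj⁵≈ε) ε-∈)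
      where
      conj⁵≈ε : pow Γ (conj g x) 5 ≈ ε
      conj⁵≈ε = trans (sym (pow-homomorphic {G = Γ} {H = Γ} (conj g) (conj-ε g) (conj-∙ g) x 5))
                      (trans (∙-congʳ (∙-congˡ (∈N⇒pow5≈ε x∈N))) (conj-ε g))

    open Quotient Γ N-isSubgroup N-normal using (quotientGroup; subgroup-of-quotient)
    private
      module Γ/N = Group quotientGroup
      module Q = GroupProperties quotientGroup

    Ker-commutative-mod-N : ∀ {x y} → Ker x → Ker y → x ∙ y ∼ y ∙ x
    Ker-commutative-mod-N {x} {y} x∈Ker y∈Ker = use (at-most-four-cosets (products x y) products∈Ker)
      where
      products∈Ker : ∀ i → Ker (products x y i)
      products∈Ker 0F = Ker.ε-∈
      products∈Ker 1F = x∈Ker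
      products∈Ker 2F = y∈Ker
      products∈Ker 3F = Ker.∙-∈ x∈Ker y∈Ker
      products∈Ker 4F = Ker.∙-∈ y∈Ker x∈Ker
      use : (∃₂ λ i j → i Fin.< j × products x y i ∼ products x y j) → x ∙ y ∼ y ∙ x
      use (i , j , i<j , uᵢ∼uⱼ) = Q.products-collide⇒comm x y {i} {j} i<j uᵢ∼uⱼ

    centralizer-mod-N : ∀ z → IsSubgroup (Q.Centralizer z)
    centralizer-mod-N z = subgroup-of-quotient (Q.centralizer-isSubgroup z)

    Ker-central-mod-N : ∀ g {h} → Ker h → g ∙ h ∼ h ∙ g
    Ker-central-mod-N g {h} h∈Ker =
      use (at-most-four-cosets (λ i → conj (gⁱ i) h) (λ i → Ker-conj (gⁱ i) h∈Ker))
      where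
      gⁱ : Fin 5 → Carrier
      gⁱ i = pow Γ g (toℕ i)
      use : (∃₂ λ i j → i Fin.< j × conj (gⁱ i) h ∼ conj (gⁱ j) h) → g ∙ h ∼ h ∙ g
      use (i , j , i<j , cᵢ∼cⱼ) =
        IsSubgroup.pow-\\⇒∈ (centralizer-mod-N h) {toℕ i} {toℕ j} {g} i<j (toℕ<n j)
          (Ker-commutative-mod-N (pow5∈Ker g) h∈Ker) (Q.conj≈⇒\\∈Centralizer {gⁱ i} {gⁱ j} {h} cᵢ∼cⱼ)

    -- ker π and a preimage γ of 1 generate Γ, and both centralize y modulo N (first for y = γ).
    Γ/N-commutative : ∀ x y → x ∙ y ∼ y ∙ x
    Γ/N-commutative x y =
      generate (centralizer-mod-N y) (λ h∈Ker → ∼-sym (Ker-central-mod-N y h∈Ker)) (∼-sym (γ-central y)) x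
      where
      generate = Ker-and-preimage-of-1-generate (proj₂ (π-surj 1F))
      γ = proj₁ (π-surj 1F)
      γ-central : ∀ x → x ∙ γ ∼ γ ∙ x
      γ-central = generate (centralizer-mod-N γ) (λ h∈Ker → ∼-sym (Ker-central-mod-N γ h∈Ker)) (≈⇒∼ refl)

    derived∼ε : ∀ {x} → InDerived Γ x → x ∼ ε
    derived∼ε (d-ε x≈ε) = ≈⇒∼ x≈ε
    derived∼ε {y} (d-step {x} a b x∈D y≈x[a,b]) = begin
      y                  ≈⟨ ≈⇒∼ y≈x[a,b] ⟩
      x ∙ [_,_] Γ a b    ≈⟨ Γ/N.∙-cong (derived∼ε x∈D) (Q.commutative⇒[,]≈ε Γ/N-commutative a b) ⟩
      ε ∙ ε              ≈⟨ Γ/N.identityˡ ε ⟩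
      ε                  ∎
      where open import Relation.Binary.Reasoning.Setoid Γ/N.setoid

    pow-5^k∈N⇒∈N : ∀ k {x} → Ker x → N (pow Γ x (5 ^ k)) → N x
    pow-5^k∈N⇒∈N zero    x∈Ker x¹∈N = ∈-resp-≈ (identityʳ _) x¹∈N
    pow-5^k∈N⇒∈N (suc k) {x} x∈Ker x^5^[1+k]∈N =
      pow-5^k∈N⇒∈N k x∈Ker (pow5∈N⇒∈N (Ker.pow-∈ (5 ^ k) x∈Ker) (∈-resp-≈ (pow-* x 5 (5 ^ k)) x^5^[1+k]∈N))

    5-group⇒Ker⊆N : AbelianizationIsPGroup Γ 5 → ∀ {x} → Ker x → N x
    5-group⇒Ker⊆N 5-group {x} x∈Ker with k , x^5^k∈D ← 5-group x =
      pow-5^k∈N⇒∈N k x∈Ker (∼ε⇒∈ (derived∼ε x^5^k∈D))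

  Ker⊈N : 5 < n → ¬ (∀ {x} → Ker x → N x)
  Ker⊈N 5<n Ker⊆N = use (pigeonhole 5<n (proj₁ ∘ ι-element∈N))
    where
    ι-element∈N : ∀ i → N (ι (element i))
    ι-element∈N i = Ker⊆N (ι∈Ker (element i))
    use : (∃₂ λ i j → i Fin.< j × proj₁ (ι-element∈N i) ≡ proj₁ (ι-element∈N j)) → ⊥
    use (i , j , i<j , kᵢ≡kⱼ) = <-irrefl (element-injective (ι.injective ιᵢ≈ιⱼ)) i<j
      where
      ιᵢ≈ιⱼ : ι (element i) ≈ ι (element j)
      ιᵢ≈ιⱼ = trans (proj₂ (ι-element∈N i))
                    (trans (reflexive (cong (pow Γ α ∘ toℕ) kᵢ≡kⱼ)) (sym (proj₂ (ι-element∈N j))))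

  abelianization-not-5-group : n < 25 → 5 < n → ¬ AbelianizationIsPGroup Γ 5
  abelianization-not-5-group n<25 5<n 5-group = Ker⊈N 5<n (5-group⇒Ker⊆N n<25 5-group)

extension-of-order-5m-not-5-group :
  ∀ {c₁ ℓ₁ c₂ ℓ₂} {H : Group c₁ ℓ₁} {Γ : Group c₂ ℓ₂} {n} → HasOrder H n → 5 ∣ n → 5 < n → n < 25 →
  IsExtensionℤ/5 H Γ → ¬ AbelianizationIsPGroup Γ 5
extension-of-order-5m-not-5-group {H = H} ord 5∣n 5<n n<25 E
  with a , a≉ε , a⁵≈ε ← FiniteGroup.cauchy-5 H ord 5∣n =
  ModuloOrder5Subgroup.abelianization-not-5-group ord E a≉ε a⁵≈ε n<25 5<n

lemma3p5 : ∀ {c₁ ℓ₁ c₂ ℓ₂ : Level} (H : Group c₁ ℓ₁) (Γ : Group c₂ ℓ₂) →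
           (HasOrder H 10 ⊎ HasOrder H 15 ⊎ HasOrder H 20) →
           IsExtensionℤ/5 H Γ →
           ¬ AbelianizationIsPGroup Γ 5
lemma3p5 H Γ (inj₁ ord) =
  extension-of-order-5m-not-5-group ord (divides 2 ≡.refl) (from-yes (5 <? 10)) (from-yes (10 <? 25))
lemma3p5 H Γ (inj₂ (inj₁ ord)) =
  extension-of-order-5m-not-5-group ord (divides 3 ≡.refl) (from-yes (5 <? 15)) (from-yes (15 <? 25))
lemma3p5 H Γ (inj₂ (inj₂ ord)) =
  extension-of-order-5m-not-5-group ord (divides 4 ≡.refl) (from-yes (5 <? 20)) (from-yes (20 <? 25))
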